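{- For every integer $k\ge2$ and every integer $n\ge1$, $\rho_k(n)<n/(k-1)$ and $\sigma_k(n)<n(k+1)/(k-1)$.
   Context: Strings are indexed from 1. An integer $p\ge1$ is a period of $s$ if $s[m]=s[m+p]$ for all $1\le m\le |s|-p$. A run of a string $w$ of length $n$ is a triple $(i,j,p)$ with $1\le i\le j\le n$ such that $p$ is the smallest period of $w[i..j]$, $j-i+1\ge 2p$, ($i=1$ or $w[i-1]\ne w[i+p-1]$), and ($j=n$ or $w[j+1]\ne w[j-p+1]$); its exponent is $(j-i+1)/p$. $\rho_k(n)$ is the maximum number of runs with exponent at least $k$ in a string of length $n$, and $\sigma_k(n)$ is the maximum sum of exponents of runs with exponent at least $k$ in a string of length $n$. -}

module Defs where

open import Data.Nat using (ℕ; zero; suc; _+_; _*_; _∸_; _≤_; _<_)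
open import Data.Integer using (+_)
open import Data.Rational using (ℚ; 0ℚ) renaming (_+_ to _+ℚ_; _/_ to _/ℚ_; _≤_ to _≤ℚ_)
open import Data.Vec using (Vec; []; _∷_)
open import Data.List using (List; length)
open import Data.List.Membership.Propositional using (_∈_)
open import Data.List.Relation.Unary.Unique.Propositional using (Unique)
open import Data.Product using (_×_; _,_; Σ; ∃)
open import Data.Sum using (_⊎_)
open import Relation.Binary.PropositionalEquality using (_≡_; _≢_)
open import Relation.Nullary using (¬_)
open import Function.Bundles using (_⇔_)

-- Strings over the alphabet ℕ (any string of length n over any alphabet is an
-- injective relabelling of one over ℕ, which preserves runs).

-- 1-indexed access w[m] (value 0 outside 1..n; never used there below)
get : ∀ {n} → Vec ℕ n → ℕ → ℕ
get []       _             = 0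
get (x ∷ xs) zero          = 0
get (x ∷ xs) (suc zero)    = x
get (x ∷ xs) (suc (suc m)) = get xs (suc m)

IsPeriod : ∀ {n} → Vec ℕ n → ℕ → ℕ → ℕ → Set
IsPeriod w i j p =
  1 ≤ p × (∀ m → 1 ≤ m → m + p ≤ suc j ∸ i →
           get w (i + m ∸ 1) ≡ get w (i + m ∸ 1 + p))

IsSmallestPeriod : ∀ {n} → Vec ℕ n → ℕ → ℕ → ℕ → Set
IsSmallestPeriod w i j p =
  IsPeriod w i j p × (∀ q → 1 ≤ q → q < p → ¬ IsPeriod w i j q)

Triple : Set
Triple = ℕ × ℕ × ℕ

IsRun : ∀ {n} → Vec ℕ n → Triple → Set
IsRun {n} w (i , j , p) =
  1 ≤ i × i ≤ j × j ≤ n ×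
  IsSmallestPeriod w i j p ×
  2 * p ≤ suc j ∸ i ×
  (i ≡ 1 ⊎ get w (i ∸ 1) ≢ get w (i + p ∸ 1)) ×
  (j ≡ n ⊎ get w (suc j) ≢ get w (suc j ∸ p))

-- exponent (j-i+1)/p as a rational (p ≥ 1 for runs; value 0 if p = 0)
exponent : Triple → ℚ
exponent (i , j , zero)  = 0ℚ
exponent (i , j , suc q) = (+ (suc j ∸ i)) /ℚ (suc q)

ExpAtLeast : ℕ → Triple → Set
ExpAtLeast k (i , j , p) = k * p ≤ suc j ∸ i

KRuns : ℕ → ∀ {n} → Vec ℕ n → List Triple → Set
KRuns k w L = Unique L × (∀ t → (t ∈ L) ⇔ (IsRun w t × ExpAtLeast k t))

sumExp : List Triple → ℚ
sumExp List.[] = 0ℚ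
sumExp (t List.∷ L) = exponent t +ℚ sumExp L

IsRho : ℕ → ℕ → ℕ → Set
IsRho k n r =
  (Σ (Vec ℕ n) λ w → Σ (List Triple) λ L → KRuns k w L × length L ≡ r) ×
  (∀ (w : Vec ℕ n) L → KRuns k w L → length L ≤ r)

IsSigma : ℕ → ℕ → ℚ → Set
IsSigma k n s =
  (Σ (Vec ℕ n) λ w → Σ (List Triple) λ L → KRuns k w L × sumExp L ≡ s) ×
  (∀ (w : Vec ℕ n) L → KRuns k w L → sumExp L ≤ℚ s)

-- Lyndon roots (Bannai, I, Inenaga, Nakashima, Takeda, Tsuruta).  Order the alphabet, separately for each
-- run (i, j, p), so that the letter following the run is smaller than the letter one period before it.  The
-- lexicographically least of the p windows of length p starting at positions i+1, ..., i+p is a Lyndon word,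
-- and so are its translates by multiples of p inside the run: these are the run's Lyndon roots, and their number
-- c satisfies c ≥ k - 1 and j - i + 1 < (c + 2) p, hence (k - 1) · exponent ≤ (k + 1) · c.  A Lyndon root of a
-- run cannot be continued to a longer Lyndon word in the run's order, which makes the starting positions of the
-- Lyndon roots of distinct runs distinct.  They all lie in [2, n], so the roots number at most n - 1 in total.
module Submission where

open import Data.Bool using (Bool; true; false)
import Data.Bool.Properties as Bool
open import Data.Empty using (⊥; ⊥-elim)
open import Data.Fin using (zero; suc; toℕ; fromℕ<)
import Data.Fin.Properties as Fin
import Data.Integer as ℤ
import Data.Integer.Properties as ℤ
open import Data.List using (List; []; _∷_; _++_; length; applyUpTo; lookup; concatMap)
open import Data.List.Membership.Propositional using (_∈_; find)
open import Data.List.Membership.Propositional.Properties using (∈-applyUpTo⁻; ∈-lookup; ∈-concatMap⁻)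
open import Data.List.Properties using (length-applyUpTo; length-++)
open import Data.List.Relation.Binary.Disjoint.Propositional using (Disjoint)
open import Data.List.Relation.Unary.All using (All)
import Data.List.Relation.Unary.All as All
import Data.List.Relation.Unary.All.Properties as All
open import Data.List.Relation.Unary.AllPairs using ([]; _∷_)
open import Data.List.Relation.Unary.Any using (here; there)
open import Data.List.Relation.Unary.Unique.Propositional using (Unique)
open import Data.List.Relation.Unary.Unique.Propositional.Properties using (applyUpTo⁺₁; ++⁺)
open import Data.Nat
  using (ℕ; zero; suc; _+_; _*_; _∸_; _≤_; _<_; _>_; z≤n; s≤s; s≤s⁻¹; z<s; _<?_; NonZero)
open import Data.Nat.DivMod using (_/_; _%_; m≡m%n+[m/n]*n; m%n<n; m*n/n≡m; /-monoˡ-≤; m/n*n≤m)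
open import Data.Nat.Properties
open import Algebra.Properties.CommutativeSemigroup +-commutativeSemigroup using (xy∙z≈xz∙y)
open import Data.Nat.Tactic.RingSolver using (solve)
open import Data.Product using (_×_; _,_; ∃-syntax; proj₁; proj₂)
open import Data.Rational using (ℚ)
  renaming (_+_ to _+ℚ_; _*_ to _*ℚ_; _/_ to _/ℚ_; _≤_ to _≤ℚ_; _<_ to _<ℚ_)
import Data.Rational.Properties as ℚ
open import Data.Rational.Base using (toℚᵘ)
open import Data.Rational.Properties
  using (toℚᵘ-fromℚᵘ; toℚᵘ-injective; toℚᵘ-homo-+; toℚᵘ-homo-*; toℚᵘ-cancel-≤; toℚᵘ-cancel-<)
open import Data.Rational.Unnormalised using (mkℚᵘ; *≡*; *≤*; *<*)
  renaming (_≃_ to _≃ᵘ_; _+_ to _+ᵘ_; _*_ to _*ᵘ_)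
import Data.Rational.Unnormalised.Properties as ℚᵘ
open import Data.Sum using (_⊎_; inj₁; inj₂; [_,_]′)
open import Data.Vec using (Vec)
open import Defs
open import Function using (_∘_; id; _⇔_; mk⇔; Equivalence)
import Relation.Binary.Construct.Flip.EqAndOrd as Flip
open import Relation.Binary.Definitions using (Tri; tri<; tri≈; tri>)
open import Relation.Binary.PropositionalEquality
open import Relation.Binary.Structures using (IsStrictTotalOrder)
open import Relation.Nullary using (¬_; yes; no; contradiction)
open import Relation.Nullary.Decidable using (⌊_⌋)

letterOrder : Bool → ℕ → ℕ → Set
letterOrder true  = _<_
letterOrder false = _>_

letterOrder-isStrictTotalOrder : ∀ o → IsStrictTotalOrder _≡_ (letterOrder o)
letterOrder-isStrictTotalOrder true  = <-isStrictTotalOrder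
letterOrder-isStrictTotalOrder false = Flip.isStrictTotalOrder <-isStrictTotalOrder

letterOrder-opposite : ∀ {o o' a b} → o ≢ o' → letterOrder o a b → letterOrder o' a b → ⊥
letterOrder-opposite {true}  {true}  o≢o' _ _ = o≢o' refl
letterOrder-opposite {true}  {false} _ a<b b<a = <-asym a<b b<a
letterOrder-opposite {false} {true}  _ b<a a<b = <-asym a<b b<a
letterOrder-opposite {false} {false} o≢o' _ _ = o≢o' refl

letterOrder-irrefl : ∀ o {a b} → a ≡ b → ¬ letterOrder o a b
letterOrder-irrefl o = IsStrictTotalOrder.irrefl (letterOrder-isStrictTotalOrder o)

letterOrder-asym : ∀ o {a b} → letterOrder o a b → ¬ letterOrder o b a
letterOrder-asym o = IsStrictTotalOrder.asym (letterOrder-isStrictTotalOrder o)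

orderOf : ℕ → ℕ → Bool
orderOf a b = ⌊ a <? b ⌋

orderOf-sound : ∀ {a b} → a ≢ b → letterOrder (orderOf a b) a b
orderOf-sound {a} {b} a≢b with a <? b
... | yes a<b = a<b
... | no a≮b  = ≤∧≢⇒< (≮⇒≥ a≮b) (a≢b ∘ sym)

Agree : ℕ → (ℕ → ℕ) → (ℕ → ℕ) → Set
Agree n f g = ∀ x → x < n → f x ≡ g x

Agree-++ : ∀ {l d f g} → Agree l f g → Agree d (f ∘ (l +_)) (g ∘ (l +_)) → Agree (l + d) f g
Agree-++ {l} front back x x<l+d with x <? l
... | yes x<l = front x x<l
... | no x≮l with x ∸ l | m+[n∸m]≡n (≮⇒≥ x≮l)
...   | z | refl = back z (+-cancelˡ-< l z _ x<l+d)

Agree-sym : ∀ {n f g} → Agree n f g → Agree n g f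
Agree-sym f≈g x x<n = sym (f≈g x x<n)

Agree-trans : ∀ {n f g h} → Agree n f g → Agree n g h → Agree n f h
Agree-trans f≈g g≈h x x<n = trans (f≈g x x<n) (g≈h x x<n)

Agree-≤ : ∀ {m n f g} → m ≤ n → Agree n f g → Agree m f g
Agree-≤ m≤n f≈g x x<m = f≈g x (<-≤-trans x<m m≤n)

Agree-snoc : ∀ {n f g} → Agree n f g → f n ≡ g n → Agree (suc n) f g
Agree-snoc f≈g fn≡gn x x<1+n with m≤n⇒m<n∨m≡n (s≤s⁻¹ x<1+n)
... | inj₁ x<n  = f≈g x x<n
... | inj₂ refl = fn≡gn

HasPeriod : (ℕ → ℕ) → ℕ → ℕ → Set
HasPeriod u L d = ∀ m → m + d < L → u m ≡ u (m + d)

HasPeriod-multiple : ∀ {u L p} → HasPeriod u L p → ∀ t → HasPeriod u L (t * p)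
HasPeriod-multiple {u} per zero m _ = cong u (sym (+-identityʳ m))
HasPeriod-multiple {u} {L} {p} per (suc t) m m+[p+tp]<L = begin
  u m               ≡⟨ per m (≤-<-trans (+-monoʳ-≤ m (m≤m+n p (t * p))) m+[p+tp]<L) ⟩
  u (m + p)         ≡⟨ HasPeriod-multiple per t (m + p) (subst (_< L) (sym (+-assoc m p (t * p))) m+[p+tp]<L) ⟩
  u (m + p + t * p) ≡⟨ cong u (+-assoc m p (t * p)) ⟩
  u (m + (p + t * p)) ∎
  where open ≡-Reasoning

-- Windows are offset by one (`suc a`) because a Lyndon root never begins at the first position of its run.
window : (ℕ → ℕ) → ℕ → ℕ → ℕ
window u a x = u (suc a + x)

module Periodic (u : ℕ → ℕ) {p L : ℕ} .{{_ : NonZero p}} (2p≤L : p + p ≤ L) (period : HasPeriod u L p)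
  where

  agreeing-windows⇒period : ∀ {a d} → a + d < p → Agree p (window u a) (window u (a + d)) → HasPeriod u L d
  agreeing-windows⇒period {a} {d} a+d<p agree = period-d
    where
    open ≡-Reasoning

    beyond : ∀ {m} → a < m → m + d < L → u m ≡ u (m + d)
    beyond {m} a<m m+d<L with m ∸ suc a | m+[n∸m]≡n a<m
    ... | y | refl with y % p | y / p | m≡m%n+[m/n]*n y p | m%n<n y p
    ...   | r | t | refl | r<p = begin
      u (suc a + (r + t * p))     ≡⟨ cong u reassoc ⟩
      u (suc a + r + t * p)       ≡⟨ HasPeriod-multiple period t _ (subst (_< L) reassoc m<L) ⟨
      u (suc a + r)               ≡⟨ agree r r<p ⟩
      u (suc (a + d) + r)         ≡⟨ HasPeriod-multiple period t _ (subst (_< L) shifted m+d<L) ⟩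
      u (suc (a + d) + r + t * p) ≡⟨ cong u (sym shifted) ⟩
      u (suc a + (r + t * p) + d) ∎
      where
      reassoc : suc a + (r + t * p) ≡ suc a + r + t * p
      reassoc = sym (+-assoc (suc a) r (t * p))
      shifted : suc a + (r + t * p) + d ≡ suc (a + d) + r + t * p
      shifted = solve (a ∷ d ∷ r ∷ t ∷ p ∷ [])
      m<L : suc a + (r + t * p) < L
      m<L = ≤-<-trans (m≤m+n _ d) m+d<L

    period-d : HasPeriod u L d
    period-d m m+d<L with a <? m
    ... | yes a<m = beyond a<m m+d<L
    ... | no a≮m = begin
      u m           ≡⟨ period m (<-≤-trans (+-monoˡ-< p m<p) 2p≤L) ⟩
      u (m + p)     ≡⟨ beyond (<-≤-trans a<p (m≤n+m p m)) m+p+d<L ⟩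
      u (m + p + d) ≡⟨ cong u (xy∙z≈xz∙y m p d) ⟩
      u (m + d + p) ≡⟨ sym (period (m + d) (<-≤-trans (+-monoˡ-< p m+d<p) 2p≤L)) ⟩
      u (m + d) ∎
      where
      m+d<p : m + d < p
      m+d<p = ≤-<-trans (+-monoˡ-≤ d (≮⇒≥ a≮m)) a+d<p
      m<p : m < p
      m<p = ≤-<-trans (m≤m+n m d) m+d<p
      a<p : a < p
      a<p = ≤-<-trans (m≤m+n a d) a+d<p
      m+p+d<L : m + p + d < L
      m+p+d<L = subst (_< L) (xy∙z≈xz∙y m d p) (<-≤-trans (+-monoˡ-< p m+d<p) 2p≤L)

  rotation : ∀ {a₀ d l} → a₀ < p → 0 < d → 0 < l → d + l ≡ p →
             ∃[ a ] a < p × a ≢ a₀ ×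
                    Agree l (window u a) (window u a₀ ∘ (d +_)) × Agree d (window u a ∘ (l +_)) (window u a₀)
  rotation {a₀} {d} {l} a₀<p 0<d 0<l d+l≡p with a₀ <? l
  ... | yes a₀<l = a₀ + d , a₀+d<p , <⇒≢ (m<m+n a₀ 0<d) ∘ sym , front , back
    where
    a₀+d<p : a₀ + d < p
    a₀+d<p = subst (a₀ + d <_) (trans (+-comm l d) d+l≡p) (+-monoˡ-< d a₀<l)
    front : Agree l (window u (a₀ + d)) (window u a₀ ∘ (d +_))
    front x _ = cong u (+-assoc (suc a₀) d x)
    back : Agree d (window u (a₀ + d) ∘ (l +_)) (window u a₀)
    back z z<d = sym (trans (period (suc a₀ + z) bound) (cong u shifted))
      where
      bound : suc a₀ + z + p < L
      bound = <-≤-trans (+-monoˡ-< p (≤-<-trans (+-monoʳ-< a₀ z<d) a₀+d<p)) 2p≤L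
      shifted : suc a₀ + z + p ≡ suc (a₀ + d) + (l + z)
      shifted = trans (cong (suc a₀ + z +_) (sym d+l≡p)) (solve (a₀ ∷ d ∷ l ∷ z ∷ []))
  ... | no a₀≮l with a₀ ∸ l | m+[n∸m]≡n (≮⇒≥ a₀≮l)
  ...   | e | refl = e , ≤-<-trans (m≤n+m e l) a₀<p , <⇒≢ (m<n+m e 0<l) , front , back
    where
    front : Agree l (window u e) (window u (l + e) ∘ (d +_))
    front x x<l = trans (period (suc e + x) bound) (cong u shifted)
      where
      bound : suc e + x + p < L
      bound = <-≤-trans (+-monoˡ-< p (≤-<-trans e+x<a₀ a₀<p)) 2p≤L
        where
        e+x<a₀ : e + x < l + e
        e+x<a₀ = subst (e + x <_) (+-comm e l) (+-monoʳ-< e x<l)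
      shifted : suc e + x + p ≡ suc (l + e) + (d + x)
      shifted = trans (cong (suc e + x +_) (sym d+l≡p)) (solve (e ∷ x ∷ d ∷ l ∷ []))
    back : Agree d (window u e ∘ (l +_)) (window u (l + e))
    back z _ = cong u (solve (e ∷ l ∷ z ∷ []))

  window-shift : ∀ a t → suc a + t * p + p ≤ L → Agree p (window u a) (window u (a + t * p))
  window-shift a t bound x x<p =
    trans (HasPeriod-multiple period t (suc a + x) (subst (_< L) (sym swap) (<-≤-trans (+-monoʳ-< _ x<p) bound)))
          (cong u swap)
    where
    swap : suc a + x + t * p ≡ suc a + t * p + x
    swap = xy∙z≈xz∙y (suc a) x (t * p)

module Lexicographic {_≺_ : ℕ → ℕ → Set} (≺-isStrictTotalOrder : IsStrictTotalOrder _≡_ _≺_) where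
  open IsStrictTotalOrder ≺-isStrictTotalOrder using (compare) renaming (irrefl to ≺-irrefl; trans to ≺-trans)

  LexLess : ℕ → (ℕ → ℕ) → (ℕ → ℕ) → Set
  LexLess n f g = ∃[ x ] x < n × Agree x f g × f x ≺ g x

  lex-compare : ∀ n f g → LexLess n f g ⊎ Agree n f g ⊎ LexLess n g f
  lex-compare zero f g = inj₂ (inj₁ λ _ ())
  lex-compare (suc n) f g with lex-compare n f g
  ... | inj₁ (x , x<n , f≈g , fx≺gx) = inj₁ (x , m<n⇒m<1+n x<n , f≈g , fx≺gx)
  ... | inj₂ (inj₂ (x , x<n , g≈f , gx≺fx)) = inj₂ (inj₂ (x , m<n⇒m<1+n x<n , g≈f , gx≺fx))
  ... | inj₂ (inj₁ f≈g) with compare (f n) (g n)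
  ...   | tri< fn≺gn _ _ = inj₁ (n , ≤-refl , f≈g , fn≺gn)
  ...   | tri≈ _ fn≡gn _ = inj₂ (inj₁ (Agree-snoc f≈g fn≡gn))
  ...   | tri> _ _ gn≺fn = inj₂ (inj₂ (n , ≤-refl , Agree-sym f≈g , gn≺fn))

  LexLess⇒¬Agree : ∀ {n f g} → LexLess n f g → ¬ Agree n f g
  LexLess⇒¬Agree (x , x<n , _ , fx≺gx) f≈g = ≺-irrefl (f≈g x x<n) fx≺gx

  lex-irrefl : ∀ {n f} → ¬ LexLess n f f
  lex-irrefl f<f = LexLess⇒¬Agree f<f λ _ _ → refl

  lex-trans : ∀ {n f g h} → LexLess n f g → LexLess n g h → LexLess n f h
  lex-trans {f = f} {g} {h} (x , x<n , f≈g , fx≺gx) (y , y<n , g≈h , gy≺hy) with <-cmp x y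
  ... | tri< x<y _ _ =
    x , x<n , Agree-trans f≈g (Agree-≤ (<⇒≤ x<y) g≈h) , subst (f x ≺_) (g≈h x x<y) fx≺gx
  ... | tri≈ _ refl _ =
    x , x<n , Agree-trans f≈g g≈h , ≺-trans fx≺gx gy≺hy
  ... | tri> _ _ y<x =
    y , y<n , Agree-trans (Agree-≤ (<⇒≤ y<x) f≈g) g≈h , subst (_≺ h y) (sym (f≈g y y<x)) gy≺hy

  LexLess-respˡ : ∀ {n f f' g} → Agree n f f' → LexLess n f g → LexLess n f' g
  LexLess-respˡ {g = g} f≈f' (x , x<n , f≈g , fx≺gx) =
    x , x<n , Agree-trans (Agree-sym (Agree-≤ (<⇒≤ x<n) f≈f')) f≈g , subst (_≺ g x) (f≈f' x x<n) fx≺gx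

  LexLess-respʳ : ∀ {n f g g'} → Agree n g g' → LexLess n f g → LexLess n f g'
  LexLess-respʳ {f = f} g≈g' (x , x<n , f≈g , fx≺gx) =
    x , x<n , Agree-trans f≈g (Agree-≤ (<⇒≤ x<n) g≈g') , subst (f x ≺_) (g≈g' x x<n) fx≺gx

  LexLess-≤ : ∀ {m n f g} → m ≤ n → LexLess m f g → LexLess n f g
  LexLess-≤ m≤n (x , x<m , f≈g , fx≺gx) = x , <-≤-trans x<m m≤n , f≈g , fx≺gx

  LexLess-++ : ∀ {l d f g} → Agree l f g → LexLess d (f ∘ (l +_)) (g ∘ (l +_)) → LexLess (l + d) f g
  LexLess-++ {l} front (z , z<d , back , less) = l + z , +-monoʳ-< l z<d , Agree-++ front back , less

  extend-minimal : ∀ {F : ℕ → ℕ → ℕ} {n m b} → (∀ a → a < m → ¬ LexLess n (F a) (F b)) →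
                   ¬ LexLess n (F m) (F b) → ∀ a → a < suc m → ¬ LexLess n (F a) (F b)
  extend-minimal below at-m a a<1+m with m≤n⇒m<n∨m≡n (s≤s⁻¹ a<1+m)
  ... | inj₁ a<m  = below a a<m
  ... | inj₂ refl = at-m

  lex-minimum : ∀ (F : ℕ → ℕ → ℕ) n m →
                ∃[ a₀ ] a₀ < suc m × (∀ a → a < suc m → ¬ LexLess n (F a) (F a₀))
  lex-minimum F n zero = 0 , z<s , extend-minimal (λ _ ()) lex-irrefl
  lex-minimum F n (suc m) with lex-minimum F n m
  ... | a₀ , a₀<1+m , minimal with lex-compare n (F (suc m)) (F a₀)
  ...   | inj₁ new<old =
    suc m , ≤-refl , extend-minimal (λ a a<1+m a<new → minimal a a<1+m (lex-trans a<new new<old)) lex-irrefl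
  ...   | inj₂ (inj₁ new≈old) =
    a₀ , m<n⇒m<1+n a₀<1+m , extend-minimal minimal (λ new<old → LexLess⇒¬Agree new<old new≈old)
  ...   | inj₂ (inj₂ old<new) =
    a₀ , m<n⇒m<1+n a₀<1+m , extend-minimal minimal (λ new<old → lex-irrefl (lex-trans old<new new<old))

  IsLyndon : ℕ → (ℕ → ℕ) → Set
  IsLyndon p f = ∀ d l → 0 < d → 0 < l → d + l ≡ p → LexLess l f (f ∘ (d +_))

  IsLyndon-resp : ∀ {p f g} → Agree p f g → IsLyndon p f → IsLyndon p g
  IsLyndon-resp f≈g lyndon d l 0<d 0<l d+l≡p =
    LexLess-respʳ (λ x x<l → f≈g (d + x) (subst (d + x <_) d+l≡p (+-monoʳ-< d x<l)))
      (LexLess-respˡ (Agree-≤ (subst (_ ≤_) d+l≡p (m≤n+m l d)) f≈g) (lyndon d l 0<d 0<l d+l≡p))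

  IsLyndon-head≺last : ∀ {q f} → IsLyndon (suc q) f → 0 < q → f 0 ≺ f q
  IsLyndon-head≺last {q} {f} lyndon 0<q with lyndon q 1 0<q z<s (+-comm q 1)
  ... | zero , _ , _ , less = subst (f 0 ≺_) (cong f (+-identityʳ q)) less
  ... | suc _ , s≤s () , _

  module _ (u : ℕ → ℕ) {p L : ℕ} .{{_ : NonZero p}} (2p≤L : p + p ≤ L) (period : HasPeriod u L p)
           (no-shorter-period : ∀ d → 0 < d → d < p → ¬ HasPeriod u L d) where
    open Periodic u 2p≤L period

    ordered-windows-disagree : ∀ {a a'} → a < a' → a' < p → ¬ Agree p (window u a) (window u a')
    ordered-windows-disagree {a} {a'} a<a' a'<p agree with a' ∸ a | m+[n∸m]≡n (<⇒≤ a<a')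
    ... | d | refl = no-shorter-period d 0<d (≤-<-trans (m≤n+m d a) a'<p) (agreeing-windows⇒period a'<p agree)
      where
      0<d : 0 < d
      0<d = +-cancelˡ-< a 0 d (subst (_< a + d) (sym (+-identityʳ a)) a<a')

    distinct-windows-disagree : ∀ {a a'} → a < p → a' < p → a ≢ a' → ¬ Agree p (window u a) (window u a')
    distinct-windows-disagree {a} {a'} a<p a'<p a≢a' agree with <-cmp a a'
    ... | tri< a<a' _ _ = ordered-windows-disagree a<a' a'<p agree
    ... | tri≈ _ a≡a' _ = a≢a' a≡a'
    ... | tri> _ _ a'<a = ordered-windows-disagree a'<a a<p (Agree-sym agree)

    minimal-window-isLyndon : ∀ {a₀} → a₀ < p → (∀ a → a < p → ¬ LexLess p (window u a) (window u a₀)) →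
                              IsLyndon p (window u a₀)
    minimal-window-isLyndon {a₀} a₀<p minimal d l 0<d 0<l d+l≡p = lyndon
      where
      f : ℕ → ℕ
      f = window u a₀

      l+d≡p : l + d ≡ p
      l+d≡p = trans (+-comm l d) d+l≡p

      rotation-not-smaller : ∀ d l → 0 < d → 0 < l → d + l ≡ p → ¬ LexLess l (f ∘ (d +_)) f
      rotation-not-smaller d l 0<d 0<l d+l≡p rotated<f with rotation a₀<p 0<d 0<l d+l≡p
      ... | a , a<p , _ , front , _ =
        minimal a a<p (LexLess-≤ (subst (l ≤_) d+l≡p (m≤n+m l d))
                                  (LexLess-respˡ (Agree-sym front) rotated<f))

      -- In the tie case, the rotation by d agrees with f on its first l letters; comparing the remaining d
      -- letters gives a smaller window, equal windows at distinct offsets, or a smaller rotation by l.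
      lyndon : LexLess l f (f ∘ (d +_))
      lyndon with lex-compare l f (f ∘ (d +_))
      ... | inj₁ f<rotated = f<rotated
      ... | inj₂ (inj₂ rotated<f) = contradiction rotated<f (rotation-not-smaller d l 0<d 0<l d+l≡p)
      ... | inj₂ (inj₁ f≈rotated) with rotation a₀<p 0<d 0<l d+l≡p | lex-compare d f (f ∘ (l +_))
      ...   | a , a<p , a≢a₀ , front , back | inj₁ less =
        contradiction (subst (λ q → LexLess q (window u a) f) l+d≡p
                        (LexLess-++ (Agree-trans front (Agree-sym f≈rotated))
                                    (LexLess-respˡ (Agree-sym back) less)))
                      (minimal a a<p)
      ...   | a , a<p , a≢a₀ , front , back | inj₂ (inj₁ agree) =
        contradiction (subst (λ q → Agree q (window u a) f) l+d≡p
                        (Agree-++ (Agree-trans front (Agree-sym f≈rotated)) (Agree-trans back agree)))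
                      (distinct-windows-disagree a<p a₀<p a≢a₀)
      ...   | _ | inj₂ (inj₂ greater) = contradiction greater (rotation-not-smaller l d 0<l 0<d l+d≡p)

pred≤quotient : ∀ {k L a} p .{{_ : NonZero p}} → a < p → k * p ≤ L → k ∸ 1 ≤ (L ∸ suc a) / p
pred≤quotient {zero} p _ _ = z≤n
pred≤quotient {suc k} {L} {a} p a<p kp≤L = begin
  k                ≡⟨ m*n/n≡m k p ⟨
  k * p / p        ≤⟨ /-monoˡ-≤ p (m+n≤o⇒m≤o∸n (k * p) kp+a<L) ⟩
  (L ∸ suc a) / p  ∎
  where
  open ≤-Reasoning
  kp+a<L : k * p + suc a ≤ L
  kp+a<L = ≤-trans (+-monoʳ-≤ (k * p) a<p) (≤-trans (≤-reflexive (+-comm (k * p) p)) kp≤L)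

<[2+quotient]*p : ∀ {L a} p .{{_ : NonZero p}} → a < p → a < L → L < (2 + (L ∸ suc a) / p) * p
<[2+quotient]*p {L} {a} p a<p a<L = begin-strict
  L                           ≡⟨ m∸n+n≡m a<L ⟨
  R + suc a                   <⟨ +-monoˡ-< (suc a) R<[1+c]p ⟩
  suc c * p + suc a           ≤⟨ +-monoʳ-≤ (suc c * p) a<p ⟩
  suc c * p + p               ≡⟨ +-comm (suc c * p) p ⟩
  (2 + c) * p                 ∎
  where
  open ≤-Reasoning
  R = L ∸ suc a
  c = R / p
  R<[1+c]p : R < suc c * p
  R<[1+c]p = subst (_< suc c * p) (sym (m≡m%n+[m/n]*n R p)) (+-monoˡ-< (c * p) (m%n<n R p))

multiple<quotient⇒fits : ∀ {s m} p .{{_ : NonZero p}} → s < m / p → s * p + p ≤ m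
multiple<quotient⇒fits {s} {m} p s<m/p = begin
  s * p + p  ≡⟨ +-comm (s * p) p ⟩
  suc s * p  ≤⟨ *-monoˡ-≤ p s<m/p ⟩
  m / p * p  ≤⟨ m/n*n≤m m p ⟩
  m          ∎
  where open ≤-Reasoning

exponent-numerator-bound : ∀ {L c p K} → L < (2 + c) * p → K ≤ c → L * K ≤ c * (suc K + 1) * p
exponent-numerator-bound {L} {c} {p} {K} L<[2+c]p K≤c = begin
  L * K                 ≤⟨ *-monoˡ-≤ K (<⇒≤ L<[2+c]p) ⟩
  (2 + c) * p * K       ≡⟨ solve (c ∷ p ∷ K ∷ []) ⟩
  (c * K + 2 * K) * p   ≤⟨ *-monoˡ-≤ p (+-monoʳ-≤ (c * K) (*-monoʳ-≤ 2 K≤c)) ⟩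
  (c * K + 2 * c) * p   ≡⟨ solve (c ∷ p ∷ K ∷ []) ⟩
  c * (suc K + 1) * p   ∎
  where open ≤-Reasoning

lookup-injective : ∀ {A : Set} {xs : List A} → Unique xs → ∀ i j → lookup xs i ≡ lookup xs j → i ≡ j
lookup-injective (_ ∷ _) zero zero _ = refl
lookup-injective (x∉xs ∷ _) zero (suc j) x≡xⱼ = ⊥-elim (All.lookup x∉xs (∈-lookup j) x≡xⱼ)
lookup-injective (x∉xs ∷ _) (suc i) zero xᵢ≡x = ⊥-elim (All.lookup x∉xs (∈-lookup i) (sym xᵢ≡x))
lookup-injective (_ ∷ unique) (suc i) (suc j) xᵢ≡xⱼ = cong suc (lookup-injective unique i j xᵢ≡xⱼ)

-- Pigeonhole: x ↦ x ∸ a maps the list injectively into Fin (b ∸ a).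
unique-interval-length : ∀ {a b} {xs : List ℕ} → Unique xs → All (λ x → a ≤ x × x < b) xs →
                         length xs ≤ b ∸ a
unique-interval-length {a} {b} {xs} unique bounded = ≮⇒≥ λ b∸a<length →
  let i , j , i<j , same-offset = Fin.pigeonhole b∸a<length (λ i → fromℕ< (offset<b∸a i))
  in Fin.<-irrefl (lookup-injective unique i j
       (∸-cancelʳ-≡ (a≤ i) (a≤ j) (trans (sym (Fin.toℕ-fromℕ< (offset<b∸a i)))
                                   (trans (cong toℕ same-offset) (Fin.toℕ-fromℕ< (offset<b∸a j)))))) i<j
  where
  a≤ : ∀ i → a ≤ lookup xs i
  a≤ i = proj₁ (All.lookup bounded (∈-lookup i))
  offset<b∸a : ∀ i → lookup xs i ∸ a < b ∸ a
  offset<b∸a i = ∸-monoˡ-< (proj₂ (All.lookup bounded (∈-lookup i))) (a≤ i)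

toℚ : ℕ → ℚ
toℚ a = ℤ.+ a /ℚ 1

toℚᵘ-toℚ : ∀ a → toℚᵘ (toℚ a) ≃ᵘ mkℚᵘ (ℤ.+ a) 0
toℚᵘ-toℚ a = toℚᵘ-fromℚᵘ (mkℚᵘ (ℤ.+ a) 0)

toℚ-+ : ∀ a b → toℚ a +ℚ toℚ b ≡ toℚ (a + b)
toℚ-+ a b = toℚᵘ-injective (begin
  toℚᵘ (toℚ a +ℚ toℚ b)         ≈⟨ toℚᵘ-homo-+ (toℚ a) (toℚ b) ⟩
  toℚᵘ (toℚ a) +ᵘ toℚᵘ (toℚ b)  ≈⟨ ℚᵘ.+-cong (toℚᵘ-toℚ a) (toℚᵘ-toℚ b) ⟩
  mkℚᵘ (ℤ.+ a) 0 +ᵘ mkℚᵘ (ℤ.+ b) 0  ≈⟨ *≡* (cong (ℤ._* ℤ.+ 1) sum≡) ⟩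
  mkℚᵘ (ℤ.+ (a + b)) 0            ≈⟨ toℚᵘ-toℚ (a + b) ⟨
  toℚᵘ (toℚ (a + b))            ∎)
  where
  open ℚᵘ.≃-Reasoning
  sum≡ : ℤ.+ a ℤ.* ℤ.+ 1 ℤ.+ ℤ.+ b ℤ.* ℤ.+ 1 ≡ ℤ.+ (a + b)
  sum≡ = trans (cong₂ ℤ._+_ (ℤ.*-identityʳ (ℤ.+ a)) (ℤ.*-identityʳ (ℤ.+ b))) (sym (ℤ.pos-+ a b))

toℚ-mono-≤ : ∀ {a b} → a ≤ b → toℚ a ≤ℚ toℚ b
toℚ-mono-≤ {a} {b} a≤b = toℚᵘ-cancel-≤ (begin
  toℚᵘ (toℚ a)      ≃⟨ toℚᵘ-toℚ a ⟩
  mkℚᵘ (ℤ.+ a) 0    ≤⟨ *≤* (ℤ.*-monoʳ-≤-nonNeg (ℤ.+ 1) (ℤ.+≤+ a≤b)) ⟩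
  mkℚᵘ (ℤ.+ b) 0    ≃⟨ toℚᵘ-toℚ b ⟨
  toℚᵘ (toℚ b)      ∎)
  where open ℚᵘ.≤-Reasoning

toℚ-mono-< : ∀ {a b} → a < b → toℚ a <ℚ toℚ b
toℚ-mono-< {a} {b} a<b = toℚᵘ-cancel-< (begin-strict
  toℚᵘ (toℚ a)      ≃⟨ toℚᵘ-toℚ a ⟩
  mkℚᵘ (ℤ.+ a) 0    <⟨ *<* (ℤ.*-monoʳ-<-pos (ℤ.+ 1) (ℤ.+<+ a<b)) ⟩
  mkℚᵘ (ℤ.+ b) 0    ≃⟨ toℚᵘ-toℚ b ⟨
  toℚᵘ (toℚ b)      ∎)
  where open ℚᵘ.≤-Reasoning

fraction*toℚ≤toℚ : ∀ a {q K M} → a * K ≤ M * suc q → (ℤ.+ a /ℚ suc q) *ℚ toℚ K ≤ℚ toℚ M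
fraction*toℚ≤toℚ a {q} {K} {M} aK≤M[1+q] = toℚᵘ-cancel-≤ (begin
  toℚᵘ ((ℤ.+ a /ℚ suc q) *ℚ toℚ K)       ≃⟨ toℚᵘ-homo-* (ℤ.+ a /ℚ suc q) (toℚ K) ⟩
  toℚᵘ (ℤ.+ a /ℚ suc q) *ᵘ toℚᵘ (toℚ K)  ≃⟨ ℚᵘ.*-cong (toℚᵘ-fromℚᵘ (mkℚᵘ (ℤ.+ a) q)) (toℚᵘ-toℚ K) ⟩
  mkℚᵘ (ℤ.+ a) q *ᵘ mkℚᵘ (ℤ.+ K) 0       ≤⟨ *≤* (subst₂ ℤ._≤_ numerator denominator (ℤ.+≤+ cross)) ⟩
  mkℚᵘ (ℤ.+ M) 0                         ≃⟨ toℚᵘ-toℚ M ⟨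
  toℚᵘ (toℚ M)                           ∎)
  where
  open ℚᵘ.≤-Reasoning
  cross : a * K * 1 ≤ M * suc (q * 1)
  cross = subst₂ _≤_ (sym (*-identityʳ (a * K))) (cong (λ x → M * suc x) (sym (*-identityʳ q))) aK≤M[1+q]
  numerator : ℤ.+ (a * K * 1) ≡ ℤ.+ a ℤ.* ℤ.+ K ℤ.* ℤ.+ 1
  numerator = trans (ℤ.pos-* (a * K) 1) (cong (ℤ._* ℤ.+ 1) (ℤ.pos-* a K))
  denominator : ℤ.+ (M * suc (q * 1)) ≡ ℤ.+ M ℤ.* ℤ.+ suc (q * 1)
  denominator = ℤ.pos-* M (suc (q * 1))

module LetterLex (o : Bool) = Lexicographic (letterOrder-isStrictTotalOrder o)

module Runs {n : ℕ} (w : Vec ℕ n) where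

  IsPeriod⇔HasPeriod : ∀ {i j d} → 0 < d → IsPeriod w i j d ⇔ HasPeriod (get w ∘ (i +_)) (suc j ∸ i) d
  IsPeriod⇔HasPeriod {i} {j} {d} 0<d = mk⇔ to from
    where
    open ≡-Reasoning
    index : ∀ m → i + suc m ∸ 1 ≡ i + m
    index m = cong (_∸ 1) (+-suc i m)
    to : IsPeriod w i j d → HasPeriod (get w ∘ (i +_)) (suc j ∸ i) d
    to (_ , periodic) m m+d<L = begin
      get w (i + m)             ≡⟨ cong (get w) (sym (index m)) ⟩
      get w (i + suc m ∸ 1)     ≡⟨ periodic (suc m) z<s m+d<L ⟩
      get w (i + suc m ∸ 1 + d) ≡⟨ cong (λ x → get w (x + d)) (index m) ⟩
      get w (i + m + d)         ≡⟨ cong (get w) (+-assoc i m d) ⟩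
      get w (i + (m + d))       ∎
    from : HasPeriod (get w ∘ (i +_)) (suc j ∸ i) d → IsPeriod w i j d
    from periodic = 0<d , λ where
      (suc m) _ m+d<L → begin
        get w (i + suc m ∸ 1)     ≡⟨ cong (get w) (index m) ⟩
        get w (i + m)             ≡⟨ periodic m m+d<L ⟩
        get w (i + (m + d))       ≡⟨ cong (get w) (sym (+-assoc i m d)) ⟩
        get w (i + m + d)         ≡⟨ cong (λ x → get w (x + d)) (sym (index m)) ⟩
        get w (i + suc m ∸ 1 + d) ∎

  run-period : ∀ {i j p} → IsRun w (i , j , p) → HasPeriod (get w ∘ (i +_)) (suc j ∸ i) p
  run-period (_ , _ , _ , (periodic@(0<p , _) , _) , _) = Equivalence.to (IsPeriod⇔HasPeriod 0<p) periodic

  run-primitive : ∀ {i j p} → IsRun w (i , j , p) →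
                  ∀ d → 0 < d → d < p → ¬ HasPeriod (get w ∘ (i +_)) (suc j ∸ i) d
  run-primitive (_ , _ , _ , (_ , smallest) , _) d 0<d d<p periodic =
    smallest d 0<d d<p (Equivalence.from (IsPeriod⇔HasPeriod 0<d) periodic)

  run-period-at : ∀ {i j p x} → IsRun w (i , j , p) → i ≤ x → x + p ≤ j → get w x ≡ get w (x + p)
  run-period-at {i} {j} {p} {x} run i≤x x+p≤j with x ∸ i | m+[n∸m]≡n i≤x
  ... | a | refl = trans (run-period run a a+p<L) (cong (get w) (sym (+-assoc i a p)))
    where
    reorder : suc (i + a + p) ≡ suc (a + p) + i
    reorder = cong suc (trans (+-assoc i a p) (+-comm i (a + p)))
    a+p<L : a + p < suc j ∸ i
    a+p<L = m+n≤o⇒m≤o∸n (suc (a + p)) (subst (_≤ suc j) reorder (s≤s x+p≤j))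

  runOrder : Triple → Bool
  runOrder (i , j , p) = orderOf (get w (suc j)) (get w (suc j ∸ p))

  IsLyndonRoot : Triple → ℕ → Set
  IsLyndonRoot (i , j , p) b =
    i < b × b + p ≤ suc j × LetterLex.IsLyndon (runOrder (i , j , p)) p (λ x → get w (b + x))

  lyndon-root-maximal : ∀ {i j p b q} → IsRun w (i , j , p) → IsLyndonRoot (i , j , p) b →
                        p < q → b + q ≤ suc n →
                        ¬ LetterLex.IsLyndon (runOrder (i , j , p)) q (λ x → get w (b + x))
  lyndon-root-maximal {i} {j} {p} {b} {q} run@(_ , _ , _ , ((0<p , _) , _) , _ , _ , right-end)
                      (i<b , b+p≤1+j , _) p<q b+q≤1+n lyndon
    with q ∸ suc p | m+[n∸m]≡n p<q
  ... | e | refl with lyndon p (suc e) 0<p z<s (+-suc p e)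
  ... | x , x<1+e , agree , less = by-position (<-cmp x y₀)
    where
    o : Bool
    o = runOrder (i , j , p)
    y₀ : ℕ
    y₀ = suc j ∸ (b + p)
    after-end : b + (p + y₀) ≡ suc j
    after-end = trans (sym (+-assoc b p y₀)) (m+[n∸m]≡n b+p≤1+j)
    period-before-end : suc j ∸ p ≡ b + y₀
    period-before-end = begin
      suc j ∸ p           ≡⟨ cong (_∸ p) (sym after-end) ⟩
      b + (p + y₀) ∸ p    ≡⟨ cong (λ z → b + z ∸ p) (+-comm p y₀) ⟩
      b + (y₀ + p) ∸ p    ≡⟨ cong (_∸ p) (sym (+-assoc b y₀ p)) ⟩
      b + y₀ + p ∸ p      ≡⟨ m+n∸n≡m (b + y₀) p ⟩
      b + y₀              ∎
      where open ≡-Reasoning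
    j<n : y₀ ≤ x → j < n
    j<n y₀≤x = s≤s⁻¹ (begin-strict
      suc j          ≡⟨ after-end ⟨
      b + (p + y₀)   ≤⟨ +-monoʳ-≤ b (+-monoʳ-≤ p y₀≤x) ⟩
      b + (p + x)    <⟨ +-monoʳ-< b (s≤s (+-monoʳ-≤ p (s≤s⁻¹ x<1+e))) ⟩
      b + suc (p + e) ≤⟨ b+q≤1+n ⟩
      suc n          ∎)
      where open ≤-Reasoning
    mismatch : y₀ ≤ x → get w (suc j) ≢ get w (suc j ∸ p)
    mismatch y₀≤x = [ (λ j≡n _ → <⇒≢ (j<n y₀≤x) j≡n) , id ]′ right-end
    -- x is where the word first differs from its shift by p, and y₀ is the offset of the letter after the run.
    by-position : Tri (x < y₀) (x ≡ y₀) (y₀ < x) → ⊥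
    by-position (tri< x<y₀ _ _) =
      letterOrder-irrefl o (trans (run-period-at run i≤b+x b+x+p≤j) (cong (get w) swap)) less
      where
      swap : b + x + p ≡ b + (p + x)
      swap = trans (+-assoc b x p) (cong (b +_) (+-comm x p))
      i≤b+x : i ≤ b + x
      i≤b+x = ≤-trans (<⇒≤ i<b) (m≤m+n b x)
      b+x+p≤j : b + x + p ≤ j
      b+x+p≤j = s≤s⁻¹ (subst₂ _<_ (sym swap) after-end (+-monoʳ-< b (+-monoʳ-< p x<y₀)))
    by-position (tri≈ _ x≡y₀ _) =
      letterOrder-asym o (orderOf-sound (mismatch (≤-reflexive (sym x≡y₀))))
        (subst₂ (letterOrder o) (cong (get w) (trans (cong (b +_) x≡y₀) (sym period-before-end)))
                                (cong (get w) (trans (cong (λ z → b + (p + z)) x≡y₀) after-end)) less)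
    by-position (tri> _ _ y₀<x) =
      mismatch (<⇒≤ y₀<x) (trans (cong (get w) (sym after-end))
                                 (trans (sym (agree y₀ y₀<x)) (cong (get w) (sym period-before-end))))

  run-left-maximal : ∀ {i j i' j' p} → IsRun w (i , j , p) → IsRun w (i' , j' , p) →
                     i < i' → i' + p ≤ suc j → ⊥
  run-left-maximal {i' = zero} _ _ () _
  run-left-maximal {i} {i' = suc i''} run@(1≤i , _) (_ , _ , _ , _ , _ , left-end , _) i<i' i'+p≤1+j =
    [ (λ i'≡1 → <⇒≱ (subst (i <_) i'≡1 i<i') 1≤i)
    , (λ letters-differ → letters-differ (run-period-at run (s≤s⁻¹ i<i') (s≤s⁻¹ i'+p≤1+j)))
    ]′ left-end

  run-right-maximal : ∀ {i j i' j' p} → IsRun w (i , j , p) → IsRun w (i' , j' , p) →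
                      j < j' → i' + p ≤ suc j → ⊥
  run-right-maximal {i} {j} {i'} {j'} {p} (_ , _ , _ , _ , _ , _ , right-end) run'@(_ , _ , j'≤n , _)
                    j<j' i'+p≤1+j =
    [ (λ j≡n → <⇒≢ (<-≤-trans j<j' j'≤n) j≡n)
    , (λ letters-differ → letters-differ (sym (trans (run-period-at run' i'≤1+j-p 1+j-p+p≤j')
                                                     (cong (get w) 1+j-p+p≡1+j))))
    ]′ right-end
    where
    1+j-p+p≡1+j : suc j ∸ p + p ≡ suc j
    1+j-p+p≡1+j = m∸n+n≡m (m+n≤o⇒n≤o i' i'+p≤1+j)
    i'≤1+j-p : i' ≤ suc j ∸ p
    i'≤1+j-p = m+n≤o⇒m≤o∸n i' i'+p≤1+j
    1+j-p+p≤j' : suc j ∸ p + p ≤ j'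
    1+j-p+p≤j' = subst (_≤ j') (sym 1+j-p+p≡1+j) j<j'

  same-period-overlap⇒same-run : ∀ {i j i' j' p b} → IsRun w (i , j , p) → IsRun w (i' , j' , p) →
                                 i ≤ b → b + p ≤ suc j → i' ≤ b → b + p ≤ suc j' →
                                 (i , j , p) ≡ (i' , j' , p)
  same-period-overlap⇒same-run {i} {j} {i'} {j'} {p} run run' i≤b b+p≤1+j i'≤b b+p≤1+j'
    with <-cmp i i' | <-cmp j j'
  ... | tri< i<i' _ _ | _ = ⊥-elim (run-left-maximal run run' i<i' (≤-trans (+-monoˡ-≤ p i'≤b) b+p≤1+j))
  ... | tri> _ _ i'<i | _ = ⊥-elim (run-left-maximal run' run i'<i (≤-trans (+-monoˡ-≤ p i≤b) b+p≤1+j'))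
  ... | _ | tri< j<j' _ _ = ⊥-elim (run-right-maximal run run' j<j' (≤-trans (+-monoˡ-≤ p i'≤b) b+p≤1+j))
  ... | _ | tri> _ _ j'<j = ⊥-elim (run-right-maximal run' run j'<j (≤-trans (+-monoˡ-≤ p i≤b) b+p≤1+j'))
  ... | tri≈ _ refl _ | tri≈ _ refl _ = refl

  root-preceded-by-period : ∀ {i j p b} → IsRun w (i , j , p) → IsLyndonRoot (i , j , p) (suc b) →
                            get w b ≡ get w (b + p)
  root-preceded-by-period run (i<1+b , 1+b+p≤1+j , _) = run-period-at run (s≤s⁻¹ i<1+b) (s≤s⁻¹ 1+b+p≤1+j)

  root-head≺previous : ∀ {i j q b} → IsRun w (i , j , suc q) → IsLyndonRoot (i , j , suc q) (suc b) → 0 < q →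
                       letterOrder (runOrder (i , j , suc q)) (get w (suc b)) (get w b)
  root-head≺previous {i} {j} {q} {b} run root@(_ , _ , lyndon) 0<q =
    subst₂ (letterOrder (runOrder (i , j , suc q)))
           (cong (get w) (+-identityʳ (suc b)))
           (sym (trans (root-preceded-by-period run root) (cong (get w) (+-suc b q))))
           (LetterLex.IsLyndon-head≺last (runOrder (i , j , suc q)) lyndon 0<q)

  -- Both roots compare their first letter with the letter preceding them, in opposite orders.
  opposite-orders-distinct-roots : ∀ {i j p i' j' q' b} → IsRun w (i , j , p) → IsRun w (i' , j' , suc q') →
                                   p < suc q' →
                                   IsLyndonRoot (i , j , p) (suc b) → IsLyndonRoot (i' , j' , suc q') (suc b) →
                                   runOrder (i , j , p) ≢ runOrder (i' , j' , suc q') → ⊥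
  opposite-orders-distinct-roots {p = zero} (_ , _ , _ , ((() , _) , _) , _) _ _ _ _ _
  opposite-orders-distinct-roots {p = suc zero} {i'} {j'} {q'} {b} run run' p<p' root root' _ =
    letterOrder-irrefl (runOrder (i' , j' , suc q'))
      (sym (trans (root-preceded-by-period run root) (cong (get w) (+-comm b 1))))
      (root-head≺previous run' root' (s≤s⁻¹ p<p'))
  opposite-orders-distinct-roots {p = suc (suc q)} run run' p<p' root root' differ =
    letterOrder-opposite differ (root-head≺previous run root z<s)
                                (root-head≺previous run' root' (≤-trans (s≤s z≤n) (s≤s⁻¹ p<p')))

  distinct-periods-distinct-roots : ∀ {i j p i' j' p' b} → IsRun w (i , j , p) → IsRun w (i' , j' , p') →
                                    p < p' → IsLyndonRoot (i , j , p) b → IsLyndonRoot (i' , j' , p') b → ⊥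
  distinct-periods-distinct-roots {b = zero} _ _ _ (() , _) _
  distinct-periods-distinct-roots {p' = zero} _ _ () _ _
  distinct-periods-distinct-roots {i} {j} {p} {i'} {j'} {suc q'} {suc b} run run'@(_ , _ , j'≤n , _) p<p'
                                  root root'@(_ , b+p'≤1+j' , lyndon')
    with runOrder (i , j , p) Bool.≟ runOrder (i' , j' , suc q')
  ... | yes same = lyndon-root-maximal run root p<p' (≤-trans b+p'≤1+j' (s≤s j'≤n))
                     (subst (λ o → LetterLex.IsLyndon o (suc q') (λ x → get w (suc b + x))) (sym same) lyndon')
  ... | no differ = opposite-orders-distinct-roots run run' p<p' root root' differ

  lyndon-roots-disjoint : ∀ {t t' b} → IsRun w t → IsRun w t' → t ≢ t' →
                          IsLyndonRoot t b → IsLyndonRoot t' b → ⊥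
  lyndon-roots-disjoint {i , j , p} {i' , j' , p'} run run' t≢t'
                        root@(i<b , b+p≤1+j , _) root'@(i'<b , b+p'≤1+j' , _)
    with <-cmp p p'
  ... | tri< p<p' _ _ = distinct-periods-distinct-roots run run' p<p' root root'
  ... | tri> _ _ p'<p = distinct-periods-distinct-roots run' run p'<p root' root
  ... | tri≈ _ refl _ =
    t≢t' (same-period-overlap⇒same-run run run' (<⇒≤ i<b) b+p≤1+j (<⇒≤ i'<b) b+p'≤1+j')

  minimalWindow : ∀ i j q → ∃[ a₀ ] a₀ < suc q ×
                  (∀ a → a < suc q → ¬ LetterLex.LexLess (runOrder (i , j , suc q)) (suc q)
                                                          (window (get w ∘ (i +_)) a) (window (get w ∘ (i +_)) a₀))
  minimalWindow i j q = LetterLex.lex-minimum (runOrder (i , j , suc q)) (window (get w ∘ (i +_))) (suc q) q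

  rootOffset : ℕ → ℕ → ℕ → ℕ
  rootOffset i j q = proj₁ (minimalWindow i j q)

  rootCount : Triple → ℕ
  rootCount (i , j , zero)  = 0
  rootCount (i , j , suc q) = (suc j ∸ i ∸ suc (rootOffset i j q)) / suc q

  lyndonRoots : Triple → List ℕ
  lyndonRoots (i , j , zero)      = []
  lyndonRoots t@(i , j , suc q) = applyUpTo (λ s → i + suc (rootOffset i j q + s * suc q)) (rootCount t)

  lyndonRoots-unique : ∀ t → Unique (lyndonRoots t)
  lyndonRoots-unique (i , j , zero)  = []
  lyndonRoots-unique (i , j , suc q) = applyUpTo⁺₁ _ _ λ {s} {s'} s<s' _ eq →
    <⇒≢ s<s' (*-cancelʳ-≡ s s' (suc q)
               (+-cancelˡ-≡ (rootOffset i j q) _ _ (suc-injective (+-cancelˡ-≡ i _ _ eq))))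

  lyndonRoots-length : ∀ t → length (lyndonRoots t) ≡ rootCount t
  lyndonRoots-length (i , j , zero)    = refl
  lyndonRoots-length t@(i , j , suc q) = length-applyUpTo _ (rootCount t)

  lyndonRoots-areRoots : ∀ {t k b} → IsRun w t → 2 ≤ k → ExpAtLeast k t →
                         b ∈ lyndonRoots t → IsLyndonRoot t b
  lyndonRoots-areRoots {i , j , zero} _ _ _ ()
  lyndonRoots-areRoots {i , j , suc q} {k} run@(_ , i≤j , _) 2≤k kp≤L b∈roots
    with ∈-applyUpTo⁻ (λ s → i + suc (rootOffset i j q + s * suc q)) b∈roots
  ... | s , s<c , refl = m<m+n i z<s , root-fits , LetterLex.IsLyndon-resp o reindex lyndon
    where
    p = suc q
    L = suc j ∸ i
    u = get w ∘ (i +_)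
    o = runOrder (i , j , p)
    a₀ = rootOffset i j q
    a₀<p : a₀ < p
    a₀<p = proj₁ (proj₂ (minimalWindow i j q))
    2p≤L : p + p ≤ L
    2p≤L = ≤-trans (≤-reflexive (cong (p +_) (sym (+-identityʳ p)))) (≤-trans (*-monoˡ-≤ p 2≤k) kp≤L)
    fits : suc a₀ + s * p + p ≤ L
    fits = begin
      suc a₀ + s * p + p       ≡⟨ +-assoc (suc a₀) (s * p) p ⟩
      suc a₀ + (s * p + p)     ≤⟨ +-monoʳ-≤ (suc a₀) (multiple<quotient⇒fits p s<c) ⟩
      suc a₀ + (L ∸ suc a₀)    ≡⟨ m+[n∸m]≡n (≤-trans a₀<p (≤-trans (m≤m+n p p) 2p≤L)) ⟩
      L                        ∎
      where open ≤-Reasoning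
    root-fits : i + suc (a₀ + s * p) + p ≤ suc j
    root-fits = begin
      i + suc (a₀ + s * p) + p ≡⟨ +-assoc i _ p ⟩
      i + (suc a₀ + s * p + p) ≤⟨ +-monoʳ-≤ i fits ⟩
      i + L                    ≡⟨ m+[n∸m]≡n (m≤n⇒m≤1+n i≤j) ⟩
      suc j                    ∎
      where open ≤-Reasoning
    lyndon : LetterLex.IsLyndon o p (window u (a₀ + s * p))
    lyndon = LetterLex.IsLyndon-resp o (Periodic.window-shift u 2p≤L (run-period run) a₀ s fits)
               (LetterLex.minimal-window-isLyndon o u 2p≤L (run-period run) (run-primitive run)
                  a₀<p (proj₂ (proj₂ (minimalWindow i j q))))
    reindex : Agree p (window u (a₀ + s * p)) (λ x → get w (i + suc (a₀ + s * p) + x))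
    reindex x _ = cong (get w) (sym (+-assoc i (suc (a₀ + s * p)) x))

  root-in-interval : ∀ {t b} → IsRun w t → IsLyndonRoot t b → 2 ≤ b × b < suc n
  root-in-interval (1≤i , _ , j≤n , ((0<p , _) , _) , _) (i<b , b+p≤1+j , _) =
    ≤-trans (s≤s 1≤i) i<b , <-≤-trans (m<m+n _ 0<p) (≤-trans b+p≤1+j (s≤s j≤n))

  module Counting (K : ℕ) where

    lyndonRoots-count : ∀ {t} → IsRun w t → ExpAtLeast (2 + K) t →
                        suc K ≤ length (lyndonRoots t) ×
                        exponent t *ℚ toℚ (suc K) ≤ℚ toℚ (length (lyndonRoots t) * (2 + K + 1))
    lyndonRoots-count {i , j , zero} (_ , _ , _ , ((() , _) , _) , _) _
    lyndonRoots-count {t@(i , j , suc q)} _ kp≤L =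
      subst (λ c → suc K ≤ c × exponent t *ℚ toℚ (suc K) ≤ℚ toℚ (c * (2 + K + 1)))
            (sym (lyndonRoots-length t))
        (K+1≤c , fraction*toℚ≤toℚ (suc j ∸ i) {M = rootCount t * (2 + K + 1)}
                   (exponent-numerator-bound (<[2+quotient]*p (suc q) a₀<p a₀<L) K+1≤c))
      where
      a₀<p : rootOffset i j q < suc q
      a₀<p = proj₁ (proj₂ (minimalWindow i j q))
      a₀<L : rootOffset i j q < suc j ∸ i
      a₀<L = <-≤-trans a₀<p (≤-trans (m≤m+n (suc q) _) kp≤L)
      K+1≤c : suc K ≤ rootCount t
      K+1≤c = pred≤quotient (suc q) a₀<p kp≤L

    RunsOfExponent : List Triple → Set
    RunsOfExponent runs = ∀ {t} → t ∈ runs → IsRun w t × ExpAtLeast (2 + K) t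

    listed-root : ∀ {runs t b} → RunsOfExponent runs → t ∈ runs → b ∈ lyndonRoots t → IsLyndonRoot t b
    listed-root good t∈runs =
      lyndonRoots-areRoots {k = 2 + K} (proj₁ (good t∈runs)) (s≤s (s≤s z≤n)) (proj₂ (good t∈runs))

    allRoots-unique : ∀ runs → RunsOfExponent runs → Unique runs → Unique (concatMap lyndonRoots runs)
    allRoots-unique [] _ _ = []
    allRoots-unique (t ∷ runs) good (t∉runs ∷ unique) =
      ++⁺ (lyndonRoots-unique t) (allRoots-unique runs (good ∘ there) unique) disjoint
      where
      disjoint : Disjoint (lyndonRoots t) (concatMap lyndonRoots runs)
      disjoint (b∈t , b∈runs) with find (∈-concatMap⁻ lyndonRoots b∈runs)
      ... | t' , t'∈runs , b∈t' =
        lyndon-roots-disjoint (proj₁ (good (here refl))) (proj₁ (good (there t'∈runs)))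
                              (All.lookup t∉runs t'∈runs)
                              (listed-root good (here refl) b∈t) (listed-root good (there t'∈runs) b∈t')

    allRoots-interval : ∀ runs → RunsOfExponent runs →
                        All (λ b → 2 ≤ b × b < suc n) (concatMap lyndonRoots runs)
    allRoots-interval [] _ = All.[]
    allRoots-interval (t ∷ runs) good =
      All.++⁺ (All.tabulate λ b∈t →
                 root-in-interval (proj₁ (good (here refl))) (listed-root good (here refl) b∈t))
              (allRoots-interval runs (good ∘ there))

    runs-count : ∀ runs → RunsOfExponent runs → length runs * suc K ≤ length (concatMap lyndonRoots runs)
    runs-count [] _ = z≤n
    runs-count (t ∷ runs) good = begin
      suc K + length runs * suc K          ≤⟨ +-mono-≤ (proj₁ (lyndonRoots-count run exp))
                                                         (runs-count runs (good ∘ there)) ⟩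
      length (lyndonRoots t) + length rest ≡⟨ length-++ (lyndonRoots t) ⟨
      length (lyndonRoots t ++ rest)       ∎
      where
      open ≤-Reasoning
      rest = concatMap lyndonRoots runs
      run = proj₁ (good (here refl))
      exp = proj₂ (good (here refl))

    sumExp-bound : ∀ runs → RunsOfExponent runs →
                   sumExp runs *ℚ toℚ (suc K) ≤ℚ toℚ (length (concatMap lyndonRoots runs) * (2 + K + 1))
    sumExp-bound [] _ = ℚ.≤-reflexive (ℚ.*-zeroˡ (toℚ (suc K)))
    sumExp-bound (t ∷ runs) good = begin
      (exponent t +ℚ sumExp runs) *ℚ toℚ (suc K)              ≡⟨ ℚ.*-distribʳ-+ (toℚ (suc K)) (exponent t) _ ⟩
      exponent t *ℚ toℚ (suc K) +ℚ sumExp runs *ℚ toℚ (suc K) ≤⟨ ℚ.+-mono-≤ (proj₂ (lyndonRoots-count run exp))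
                                                                              (sumExp-bound runs (good ∘ there)) ⟩
      toℚ (roots * k+1) +ℚ toℚ (length rest * k+1)            ≡⟨ toℚ-+ (roots * k+1) (length rest * k+1) ⟩
      toℚ (roots * k+1 + length rest * k+1)                   ≡⟨ cong toℚ (*-distribʳ-+ k+1 roots (length rest)) ⟨
      toℚ ((roots + length rest) * k+1)                       ≡⟨ cong (λ m → toℚ (m * k+1)) (length-++ (lyndonRoots t)) ⟨
      toℚ (length (lyndonRoots t ++ rest) * k+1)              ∎
      where
      open ℚ.≤-Reasoning
      k+1 = 2 + K + 1
      roots = length (lyndonRoots t)
      rest = concatMap lyndonRoots runs
      run = proj₁ (good (here refl))
      exp = proj₂ (good (here refl))

    KRuns⇒RunsOfExponent : ∀ {runs} → KRuns (2 + K) w runs → RunsOfExponent runs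
    KRuns⇒RunsOfExponent (_ , characterisation) = Equivalence.to (characterisation _)

    allRoots-count : ∀ {runs} → KRuns (2 + K) w runs → length (concatMap lyndonRoots runs) ≤ suc n ∸ 2
    allRoots-count {runs} kruns@(unique , _) =
      unique-interval-length (allRoots-unique runs (KRuns⇒RunsOfExponent kruns) unique)
                             (allRoots-interval runs (KRuns⇒RunsOfExponent kruns))

open import Data.Integer using (+_)

theorem3 : ∀ (k n : ℕ) → 2 ≤ k → 1 ≤ n →
    (∀ r → IsRho k n r → r * (k ∸ 1) < n) ×
    (∀ s → IsSigma k n s → s *ℚ ((+ (k ∸ 1)) /ℚ 1) <ℚ (+ (n * (k + 1))) /ℚ 1)
theorem3 zero _ () _
theorem3 (suc zero) _ (s≤s ()) _
theorem3 (suc (suc _)) zero _ ()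
theorem3 (suc (suc K)) (suc n) _ _ = ρ-bound , σ-bound
  where
  ρ-bound : ∀ r → IsRho (2 + K) (suc n) r → r * suc K < suc n
  ρ-bound r ((w , runs , kruns , refl) , _) =
    s≤s (≤-trans (runs-count runs (KRuns⇒RunsOfExponent kruns)) (allRoots-count kruns))
    where open Runs.Counting w K
  σ-bound : ∀ s → IsSigma (2 + K) (suc n) s → s *ℚ toℚ (suc K) <ℚ toℚ (suc n * (2 + K + 1))
  σ-bound s ((w , runs , kruns , refl) , _) =
    ℚ.≤-<-trans (sumExp-bound runs (KRuns⇒RunsOfExponent kruns))
                (toℚ-mono-< (*-monoˡ-< _ (s≤s (allRoots-count kruns))))
    where open Runs.Counting w K
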